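{- Let $G$ be a connected graph with at least one edge. Then $\chi(G\,\square\,H)\le \eta(G\,\square\,H)$ holds for every connected graph $H$ with at least one edge and $\chi(G)\ge \chi(H)$ if and only if $\chi(G\,\square\,K_2)\le\eta(G\,\square\,K_2)$.
   Context: All graphs are finite, simple and undirected. $\chi$ denotes chromatic number and $\eta(G)$ is the maximum $k$ such that $K_k$ is a minor of $G$. The Cartesian product $G\,\square\,H$ has vertex set $V(G)\times V(H)$, with $(v,x)(w,y)$ an edge iff ($vw\in E(G)$ and $x=y$) or ($v=w$ and $xy\in E(H)$). A product $G\,\square\,H$ is non-trivial if $G$ and $H$ are both connected and have at least one edge. -}

module Defs where

open import Data.Nat using (ℕ; _≤_; _*_)
open import Data.Fin using (Fin; zero; suc; remQuot; _≟_)

open import Data.Bool using (Bool; true; false; _∧_; _∨_; not)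

open import Data.Maybe using (Maybe; just; nothing)
open import Data.Product using (Σ; _×_; _,_; ∃; ∃-syntax; proj₁; proj₂)
open import Data.Unit using (⊤)
open import Relation.Nullary using (¬_; yes; no)
open import Relation.Nullary.Decidable using (⌊_⌋)
open import Relation.Binary.PropositionalEquality using (_≡_; _≢_; refl; sym; cong; cong₂)

eqb : ∀ {n} → Fin n → Fin n → Bool
eqb a b = ⌊ a ≟ b ⌋

eqb-sym : ∀ {n} (a b : Fin n) → eqb a b ≡ eqb b a
eqb-sym a b with a ≟ b | b ≟ a
... | yes _ | yes _ = refl
... | no _ | no _ = refl
... | yes p | no q with q (sym p)
...   | ()
eqb-sym a b | no p | yes q with p (sym q)
...   | ()

eqb-refl : ∀ {n} (a : Fin n) → eqb a a ≡ true
eqb-refl a with a ≟ a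
... | yes _ = refl
... | no p with p refl
...   | ()

record Graph : Set where
  field
    n      : ℕ
    adj    : Fin n → Fin n → Bool
    adj-sym : ∀ u v → adj u v ≡ adj v u
    irrefl : ∀ u → adj u u ≡ false
open Graph public

V : Graph → Set
V G = Fin (n G)

Edge : (G : Graph) → V G → V G → Set
Edge G u v = adj G u v ≡ true

HasEdge : Graph → Set
HasEdge G = ∃[ u ] ∃[ v ] Edge G u v

data PathIn (G : Graph) (P : V G → Set) : V G → V G → Set where
  here : ∀ {u} → P u → PathIn G P u u
  step : ∀ {u w v} → P u → Edge G u w → PathIn G P w v → PathIn G P u v

Connected : Graph → Set
Connected G = ∀ u v → PathIn G (λ _ → ⊤) u v

Colourable : Graph → ℕ → Set
Colourable G k = Σ (V G → Fin k) λ c → ∀ u v → Edge G u v → c u ≢ c v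

IsChromaticNumber : Graph → ℕ → Set
IsChromaticNumber G k = Colourable G k × (∀ m → Colourable G m → k ≤ m)

-- K_k is a minor of G: k pairwise disjoint, nonempty, connected branch sets
-- (vertex v belongs to branch set i iff β v ≡ just i), pairwise joined by an edge.
HasCliqueMinor : Graph → ℕ → Set
HasCliqueMinor G k = Σ (V G → Maybe (Fin k)) λ β →
    (∀ i → ∃[ v ] β v ≡ just i)
  × (∀ i u v → β u ≡ just i → β v ≡ just i → PathIn G (λ w → β w ≡ just i) u v)
  × (∀ i j → i ≢ j → ∃[ u ] ∃[ v ] (β u ≡ just i × β v ≡ just j × Edge G u v))

IsHadwigerNumber : Graph → ℕ → Set
IsHadwigerNumber G k = HasCliqueMinor G k × (∀ m → HasCliqueMinor G m → m ≤ k)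

ChiLeEta : Graph → Set
ChiLeEta G = ∀ a b → IsChromaticNumber G a → IsHadwigerNumber G b → a ≤ b

ChiLe : Graph → Graph → Set
ChiLe H G = ∀ a b → IsChromaticNumber H a → IsChromaticNumber G b → a ≤ b

K2 : Graph
K2 = record { n = 2 ; adj = λ a b → not (eqb a b)
            ; adj-sym = λ a b → cong not (eqb-sym a b)
            ; irrefl = λ a → cong not (eqb-refl a) }

-- Cartesian product G □ H, vertex (v , x) encoded as an element of Fin (n G * n H)
-- via remQuot / combine.
prodAdj : (G H : Graph) → V G → V H → V G → V H → Bool
prodAdj G H v x w y = (adj G v w ∧ eqb x y) ∨ (eqb v w ∧ adj H x y)

prodAdj-sym : (G H : Graph) → ∀ v x w y → prodAdj G H v x w y ≡ prodAdj G H w y v x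
prodAdj-sym G H v x w y =
  cong₂ _∨_ (cong₂ _∧_ (adj-sym G v w) (eqb-sym x y))
            (cong₂ _∧_ (eqb-sym v w) (adj-sym H x y))

prodAdj-irr : (G H : Graph) → ∀ v x → prodAdj G H v x v x ≡ false
prodAdj-irr G H v x rewrite irrefl G v | irrefl H x | eqb-refl v = refl

fstV : (G H : Graph) → Fin (n G * n H) → V G
fstV G H p = proj₁ (remQuot {n G} (n H) p)

sndV : (G H : Graph) → Fin (n G * n H) → V H
sndV G H p = proj₂ (remQuot {n G} (n H) p)

infixl 7 _□_
_□_ : Graph → Graph → Graph
G □ H = record
  { n = n G * n H
  ; adj = λ p q → prodAdj G H (fstV G H p) (sndV G H p) (fstV G H q) (sndV G H q)
  ; adj-sym = λ p q → prodAdj-sym G H (fstV G H p) (sndV G H p) (fstV G H q) (sndV G H q)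
  ; irrefl = λ p → prodAdj-irr G H (fstV G H p) (sndV G H p) }

-- Forward: K₂ is itself connected, has an edge and satisfies χ(K₂) ≤ χ(G).
-- Backward: let H be admissible, c = χ(G □ K₂), e = η(G □ K₂).  Then
--   χ(G □ H) ≤ c   since G (a slice of G □ K₂) and H (χ(H) ≤ χ(G) ≤ c) are
--                  c-colourable, and the Latin-square colouring
--                  (v , x) ↦ c_G(v) + c_H(x) mod c of G □ H is proper;
--   c ≤ e          by hypothesis;
--   e ≤ η(G □ H)   since an edge of H embeds K₂ into H, hence G □ K₂ into
--                  G □ H, and clique minors are monotone under embeddings.
-- The numbers χ and η are only given by their defining properties, so their
-- existence is obtained classically (under ¬¬) from a minimal-element
-- principle; this suffices because the goal a ≤ b is decidable.
module Submission where

open import Defs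
open import Data.Product using (_×_; _,_; proj₁; proj₂; ∃; ∃-syntax)
open import Function.Bundles using (_⇔_; mk⇔)
open import Data.Bool using (Bool; true; false; _∧_; _∨_)
open import Data.Empty using (⊥-elim)
open import Data.Fin using (Fin; toℕ; combine; inject≤)
  renaming (zero to fzero; suc to fsuc)
import Data.Fin.Properties as Fin
open import Data.Maybe using (Maybe; just; nothing)
open import Data.Maybe.Properties using (just-injective)
open import Data.Nat using (ℕ; zero; suc; _≤_; _<_; _+_; _∸_; _*_; _%_; _≤?_; NonZero)
open import Data.Nat.DivMod using (_mod_; %-distribˡ-+; m%n%n≡m%n; [m+kn]%n≡m%n; m<n⇒m%n≡m)
open import Data.Nat.Induction using (<-wellFounded)
open import Data.Nat.Properties
  using (≤-trans; ≮⇒≥; ∸-monoʳ-<; m≤m*n; m+[n∸m]≡n; +-assoc; +-comm)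
open import Data.Sum using (_⊎_; inj₁; inj₂)
open import Data.Unit using (tt)
open import Effect.Monad using (RawMonad)
open import Function.Base using (_∘_)
open import Induction.WellFounded using (WellFounded; Acc; acc)
import Relation.Binary.Construct.On as On
open import Relation.Nullary using (¬_; Dec; yes; no)
open import Relation.Nullary.Decidable using (decidable-stable; ¬¬-excluded-middle)
open import Relation.Nullary.Negation using (¬¬-Monad; ¬¬-map)
open import Relation.Binary.PropositionalEquality

Minimal : ∀ {A : Set} → (A → A → Set) → (A → Set) → A → Set
Minimal _≺_ P m = P m × ∀ y → P y → ¬ y ≺ m

¬¬-minimal : ∀ {A : Set} {_≺_ : A → A → Set} → WellFounded _≺_ →
             (P : A → Set) → ∀ {x} → P x → ¬ ¬ ∃ (Minimal _≺_ P)
¬¬-minimal {_≺_ = _≺_} wf P {x} px = descend x (wf x) px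
  where
  descend : ∀ x → Acc _≺_ x → P x → ¬ ¬ ∃ (Minimal _≺_ P)
  descend x (acc below) px notMinimal =
    ¬¬-excluded-middle {A = ∃ λ y → P y × y ≺ x} λ where
      (yes (y , py , y≺x)) → descend y (below y≺x) py notMinimal
      (no none) → notMinimal (x , px , λ y py y≺x → none (y , py , y≺x))

edge⇒≢ : (X : Graph) → ∀ {u v} → Edge X u v → u ≢ v
edge⇒≢ X {u} e refl with trans (sym e) (irrefl X u)
... | ()

-- Every graph X is n(X)-colourable, so χ(X) exists (classically).
¬¬-chromatic : (X : Graph) → ¬ ¬ ∃ (IsChromaticNumber X)
¬¬-chromatic X = ¬¬-map least
  (¬¬-minimal <-wellFounded (Colourable X) ((λ u → u) , λ u v → edge⇒≢ X))
  where
  least : ∃ (Minimal _<_ (Colourable X)) → ∃ (IsChromaticNumber X)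
  least (k , colourable , minimal) =
    k , colourable , λ m colourableₘ → ≮⇒≥ (minimal m colourableₘ)

-- The branch sets of a K_m minor are disjoint and nonempty, so m ≤ n(X).
clique-minor-bound : (X : Graph) → ∀ {m} → HasCliqueMinor X m → m ≤ n X
clique-minor-bound X (β , nonempty , _ , _) = Fin.injective⇒≤ representative-injective
  where
  representative-injective : ∀ {i j} → proj₁ (nonempty i) ≡ proj₁ (nonempty j) → i ≡ j
  representative-injective {i} {j} same = just-injective
    (trans (sym (proj₂ (nonempty i))) (trans (cong β same) (proj₂ (nonempty j))))

-- K_0 is a minor of every graph and clique minors are bounded, so η(X)
-- exists (classically): minimise n(X) ∸ m over the clique minors K_m.
¬¬-hadwiger : (X : Graph) → ¬ ¬ ∃ (IsHadwigerNumber X)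
¬¬-hadwiger X = ¬¬-map greatest
  (¬¬-minimal (On.wellFounded (n X ∸_) <-wellFounded) (HasCliqueMinor X) trivial-minor)
  where
  trivial-minor : HasCliqueMinor X 0
  trivial-minor = (λ _ → nothing) , (λ ()) , (λ ()) , (λ ())

  greatest : ∃ (Minimal (λ m k → n X ∸ m < n X ∸ k) (HasCliqueMinor X)) →
             ∃ (IsHadwigerNumber X)
  greatest (k , minor , maximal) = k , minor , λ m minorₘ →
    ≮⇒≥ (λ k<m → maximal m minorₘ (∸-monoʳ-< k<m (clique-minor-bound X minorₘ)))

record Hom (X Y : Graph) : Set where
  field
    map      : V X → V Y
    map-edge : ∀ {u v} → Edge X u v → Edge Y (map u) (map v)

record Embedding (X Y : Graph) : Set where
  field
    hom       : Hom X Y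
    injective : ∀ {u v} → Hom.map hom u ≡ Hom.map hom v → u ≡ v
  open Hom hom public

colouring-pullback : ∀ {X Y k} → Hom X Y → Colourable Y k → Colourable X k
colouring-pullback f (c , proper) =
  c ∘ Hom.map f , λ u v e → proper _ _ (Hom.map-edge f e)

colouring-widen : ∀ {X k m} → k ≤ m → Colourable X k → Colourable X m
colouring-widen k≤m (c , proper) =
  (λ u → inject≤ (c u) k≤m) ,
  λ u v e same → proper u v e (Fin.inject≤-injective k≤m k≤m (c u) (c v) same)

edge-embedding : (H : Graph) → ∀ {x y} → Edge H x y → Embedding K2 H
edge-embedding H {x} {y} xy = record
  { hom = record { map = endpoint ; map-edge = endpoint-edge _ _ }
  ; injective = endpoint-injective _ _ }
  where
  endpoint : Fin 2 → V H
  endpoint fzero = x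
  endpoint (fsuc fzero) = y

  endpoint-edge : ∀ a b → Edge K2 a b → Edge H (endpoint a) (endpoint b)
  endpoint-edge fzero fzero ()
  endpoint-edge fzero (fsuc fzero) _ = xy
  endpoint-edge (fsuc fzero) fzero _ = trans (adj-sym H y x) xy
  endpoint-edge (fsuc fzero) (fsuc fzero) ()

  endpoint-injective : ∀ a b → endpoint a ≡ endpoint b → a ≡ b
  endpoint-injective fzero fzero _ = refl
  endpoint-injective fzero (fsuc fzero) x≡y = ⊥-elim (edge⇒≢ H xy x≡y)
  endpoint-injective (fsuc fzero) fzero y≡x = ⊥-elim (edge⇒≢ H xy (sym y≡x))
  endpoint-injective (fsuc fzero) (fsuc fzero) _ = refl

CartesianEdge : (G H : Graph) → V G → V H → V G → V H → Set
CartesianEdge G H v x w y = (Edge G v w × x ≡ y) ⊎ (v ≡ w × Edge H x y)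

eqb⇒≡ : ∀ {m} {a b : Fin m} → eqb a b ≡ true → a ≡ b
eqb⇒≡ {a = a} {b} same with a Fin.≟ b
... | yes a≡b = a≡b

∨-of-∧-true : ∀ {a b c d : Bool} → (a ∧ b) ∨ (c ∧ d) ≡ true →
              (a ≡ true × b ≡ true) ⊎ (c ≡ true × d ≡ true)
∨-of-∧-true {true} {true} _ = inj₁ (refl , refl)
∨-of-∧-true {true} {false} {true} {true} _ = inj₂ (refl , refl)
∨-of-∧-true {false} {_} {true} {true} _ = inj₂ (refl , refl)

module _ (G H : Graph) where

  fst : V (G □ H) → V G
  fst = fstV G H

  snd : V (G □ H) → V H
  snd = sndV G H

  □-edge⇒ : ∀ {p q} → Edge (G □ H) p q →
            CartesianEdge G H (fst p) (snd p) (fst q) (snd q)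
  □-edge⇒ {p} {q} e with ∨-of-∧-true {adj G (fst p) (fst q)} e
  ... | inj₁ (eG , same) = inj₁ (eG , eqb⇒≡ same)
  ... | inj₂ (same , eH) = inj₂ (eqb⇒≡ same , eH)

  prodAdj-true : ∀ {v x w y} → CartesianEdge G H v x w y → prodAdj G H v x w y ≡ true
  prodAdj-true {x = x} (inj₁ (eG , refl)) rewrite eG | eqb-refl x = refl
  prodAdj-true {v = v} (inj₂ (refl , eH)) rewrite eH | eqb-refl v | irrefl G v = refl

  □-edge⇐ : ∀ {v x w y} → CartesianEdge G H v x w y →
            Edge (G □ H) (combine v x) (combine w y)
  □-edge⇐ {v} {x} {w} {y} e =
    subst₂ (λ p q → prodAdj G H (proj₁ p) (proj₂ p) (proj₁ q) (proj₂ q) ≡ true)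
      (sym (Fin.remQuot-combine {n G} {n H} v x)) (sym (Fin.remQuot-combine {n G} {n H} w y))
      (prodAdj-true e)

  combine-coordinates : ∀ p → combine (fst p) (snd p) ≡ p
  combine-coordinates = Fin.combine-remQuot {n G} (n H)

  □-slice : V H → Hom G (G □ H)
  □-slice x = record
    { map = λ v → combine v x ; map-edge = λ e → □-edge⇐ (inj₁ (e , refl)) }

□-embedding : (G : Graph) → ∀ {H₁ H₂} → Embedding H₁ H₂ → Embedding (G □ H₁) (G □ H₂)
□-embedding G {H₁} {H₂} f = record
  { hom = record { map = image ; map-edge = image-edge }
  ; injective = image-injective }
  where
  open Embedding f renaming (map to f₀; map-edge to f-edge; injective to f-injective)

  image : V (G □ H₁) → V (G □ H₂)
  image p = combine (fst G H₁ p) (f₀ (snd G H₁ p))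

  image-edge : ∀ {p q} → Edge (G □ H₁) p q → Edge (G □ H₂) (image p) (image q)
  image-edge e with □-edge⇒ G H₁ e
  ... | inj₁ (eG , same) = □-edge⇐ G H₂ (inj₁ (eG , cong f₀ same))
  ... | inj₂ (same , eH) = □-edge⇐ G H₂ (inj₂ (same , f-edge eH))

  image-injective : ∀ {p q} → image p ≡ image q → p ≡ q
  image-injective {p} {q} same
    with Fin.combine-injective (fst G H₁ p) _ (fst G H₁ q) _ same
  ... | same-fst , same-snd = begin
    p                                      ≡⟨ combine-coordinates G H₁ p ⟨
    combine (fst G H₁ p) (snd G H₁ p)      ≡⟨ cong₂ combine same-fst (f-injective same-snd) ⟩
    combine (fst G H₁ q) (snd G H₁ q)      ≡⟨ combine-coordinates G H₁ q ⟩
    q                                      ∎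
    where open ≡-Reasoning

%-absorbˡ : ∀ m o d .{{_ : NonZero d}} → (m % d + o) % d ≡ (m + o) % d
%-absorbˡ m o d = begin
  (m % d + o) % d           ≡⟨ %-distribˡ-+ (m % d) o d ⟩
  (m % d % d + o % d) % d   ≡⟨ cong (λ t → (t + o % d) % d) (m%n%n≡m%n m d) ⟩
  (m % d + o % d) % d       ≡⟨ %-distribˡ-+ m o d ⟨
  (m + o) % d               ∎
  where open ≡-Reasoning

shift-undo : ∀ {a} k N .{{_ : NonZero N}} → a < N → ((a + k) % N + (k * N ∸ k)) % N ≡ a
shift-undo {a} k N a<N = begin
  ((a + k) % N + (k * N ∸ k)) % N   ≡⟨ %-absorbˡ (a + k) (k * N ∸ k) N ⟩
  (a + k + (k * N ∸ k)) % N         ≡⟨ cong (_% N) (+-assoc a k (k * N ∸ k)) ⟩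
  (a + (k + (k * N ∸ k))) % N       ≡⟨ cong (λ t → (a + t) % N) (m+[n∸m]≡n (m≤m*n k N)) ⟩
  (a + k * N) % N                   ≡⟨ [m+kn]%n≡m%n a k N ⟩
  a % N                             ≡⟨ m<n⇒m%n≡m a<N ⟩
  a                                 ∎
  where open ≡-Reasoning

+-%-cancelʳ : ∀ {a b} k N .{{_ : NonZero N}} → a < N → b < N →
              (a + k) % N ≡ (b + k) % N → a ≡ b
+-%-cancelʳ {a} {b} k N a<N b<N same = begin
  a                                 ≡⟨ shift-undo k N a<N ⟨
  ((a + k) % N + (k * N ∸ k)) % N   ≡⟨ cong (λ t → (t + (k * N ∸ k)) % N) same ⟩
  ((b + k) % N + (k * N ∸ k)) % N   ≡⟨ shift-undo k N b<N ⟩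
  b                                 ∎
  where open ≡-Reasoning

module LatinSquare (N : ℕ) .{{_ : NonZero N}} where

  latin : Fin N → Fin N → Fin N
  latin i j = (toℕ i + toℕ j) mod N

  latin-cancelˡ : ∀ {i j k} → latin i k ≡ latin j k → i ≡ j
  latin-cancelˡ {i} {j} {k} same = Fin.toℕ-injective
    (+-%-cancelʳ (toℕ k) N (Fin.toℕ<n i) (Fin.toℕ<n j)
      (trans (sym (Fin.toℕ-fromℕ< _)) (trans (cong toℕ same) (Fin.toℕ-fromℕ< _))))

  latin-cancelʳ : ∀ {i j k} → latin k i ≡ latin k j → i ≡ j
  latin-cancelʳ {i} {j} {k} same = latin-cancelˡ {i} {j} {k}
    (trans (cong (_mod N) (+-comm (toℕ i) (toℕ k)))
      (trans same (cong (_mod N) (+-comm (toℕ k) (toℕ j)))))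

□-colourable : ∀ {G H k} → Colourable G k → Colourable H k → Colourable (G □ H) k
□-colourable {G} {H} {zero} (cG , _) _ =
  cG ∘ fstV G H , λ p _ _ → ⊥-elim (Fin.¬Fin0 (cG (fstV G H p)))
□-colourable {G} {H} {suc M} (cG , properG) (cH , properH) = colour , proper
  where
  open LatinSquare (suc M)

  colour : V (G □ H) → Fin (suc M)
  colour p = latin (cG (fstV G H p)) (cH (sndV G H p))

  proper-coordinates : ∀ {v x w y} → CartesianEdge G H v x w y →
                       latin (cG v) (cH x) ≢ latin (cG w) (cH y)
  proper-coordinates {x = x} (inj₁ (vw , refl)) same =
    properG _ _ vw (latin-cancelˡ {k = cH x} same)
  proper-coordinates {v = v} (inj₂ (refl , xy)) same =
    properH _ _ xy (latin-cancelʳ {k = cG v} same)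

  proper : ∀ p q → Edge (G □ H) p q → colour p ≢ colour q
  proper p q e = proper-coordinates (□-edge⇒ G H e)

module _ {X Y : Graph} (f : Embedding X Y) where
  open Embedding f

  preimage? : (y : V Y) → Dec (∃ λ x → map x ≡ y)
  preimage? y = Fin.any? (λ x → map x Fin.≟ y)

  module _ {k : ℕ} (β : V X → Maybe (Fin k)) where

    push : V Y → Maybe (Fin k)
    push y with preimage? y
    ... | yes (x , _) = β x
    ... | no _ = nothing

    push-map : ∀ x → push (map x) ≡ β x
    push-map x with preimage? (map x)
    ... | yes (x′ , same) = cong β (injective same)
    ... | no none = ⊥-elim (none (x , refl))

    push-inverse : ∀ {y i} → push y ≡ just i → ∃ λ x → map x ≡ y × β x ≡ just i
    push-inverse {y} pushed with preimage? y
    ... | yes (x , same) = x , same , pushed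

    push-path : ∀ {i u v} → PathIn X (λ w → β w ≡ just i) u v →
                PathIn Y (λ w → push w ≡ just i) (map u) (map v)
    push-path {u = u} (here inside) = here (trans (push-map u) inside)
    push-path {u = u} (step inside e rest) =
      step (trans (push-map u) inside) (map-edge e) (push-path rest)

  minor-mono : ∀ {k} → HasCliqueMinor X k → HasCliqueMinor Y k
  minor-mono (β , nonempty , connected , adjacent) =
    push β , nonempty′ , connected′ , adjacent′
    where
    nonempty′ : ∀ i → ∃[ y ] push β y ≡ just i
    nonempty′ i with nonempty i
    ... | x , inside = map x , trans (push-map β x) inside

    connected′ : ∀ i u v → push β u ≡ just i → push β v ≡ just i →
                 PathIn Y (λ w → push β w ≡ just i) u v
    connected′ i u v insideᵤ insideᵥ
      with push-inverse β insideᵤ | push-inverse β insideᵥ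
    ... | x , refl , insideₓ | x′ , refl , insideₓ′ =
      push-path β (connected i x x′ insideₓ insideₓ′)

    adjacent′ : ∀ i j → i ≢ j →
                ∃[ u ] ∃[ v ] (push β u ≡ just i × push β v ≡ just j × Edge Y u v)
    adjacent′ i j i≢j with adjacent i j i≢j
    ... | u , v , insideᵤ , insideᵥ , e =
      map u , map v , trans (push-map β u) insideᵤ , trans (push-map β v) insideᵥ , map-edge e

K2-connected : Connected K2
K2-connected fzero fzero = here tt
K2-connected fzero (fsuc fzero) = step tt refl (here tt)
K2-connected (fsuc fzero) fzero = step tt refl (here tt)
K2-connected (fsuc fzero) (fsuc fzero) = here tt

K2-edge : HasEdge K2
K2-edge = fzero , fsuc fzero , refl

K2-chiLe : (G : Graph) → HasEdge G → ChiLe K2 G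
K2-chiLe G (_ , _ , uv) a b (_ , least) (colourable , _) =
  least b (colouring-pullback (Embedding.hom (edge-embedding G uv)) colourable)

chiLeEta-from-K2 : (G : Graph) → ChiLeEta (G □ K2) →
  ∀ (H : Graph) → HasEdge H → ChiLe H G → ChiLeEta (G □ H)
chiLeEta-from-K2 G hyp H (_ , _ , xy) χH≤χG a b (_ , χ-least) (_ , η-greatest) =
  decidable-stable (a ≤? b) do
    g , χG ← ¬¬-chromatic G
    h , χH ← ¬¬-chromatic H
    c , χGK ← ¬¬-chromatic (G □ K2)
    e , ηGK ← ¬¬-hadwiger (G □ K2)
    let colourG = colouring-pullback (□-slice G K2 fzero) (proj₁ χGK)
        colourH = colouring-widen {H} (≤-trans (χH≤χG h g χH χG) (proj₂ χG c colourG)) (proj₁ χH)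
        a≤c = χ-least c (□-colourable {G} {H} colourG colourH)
        e≤b = η-greatest e (minor-mono (□-embedding G (edge-embedding H xy)) (proj₁ ηGK))
    pure (≤-trans a≤c (≤-trans (hyp c e χGK ηGK) e≤b))
  where open RawMonad ¬¬-Monad

mainTheorem4 : (G : Graph) → Connected G → HasEdge G →
    ((∀ (H : Graph) → Connected H → HasEdge H → ChiLe H G → ChiLeEta (G □ H))
    ⇔ ChiLeEta (G □ K2))
mainTheorem4 G _ hasEdge = mk⇔
  (λ allH → allH K2 K2-connected K2-edge (K2-chiLe G hasEdge))
  (λ hyp H _ → chiLeEta-from-K2 G hyp H)
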